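{- Let $A$ be an LM$_\theta$-algebra. The Boolean algebra $Con_{bLM_\theta}(A)$ of Boolean congruences of $A$ is isomorphic to the Boolean algebra $C(A)$ of Boolean elements of $A$; in particular $|Con_{bLM_\theta}(A)|=|C(A)|$.
   Context: Let $\theta\ge 2$ be the order type of a totally ordered set $J$ with least element $0$, $J=\{0\}+I$ (ordinal sum). An LM$_\theta$-algebra is an algebra $\langle A,\vee,\wedge,0,1,\{\phi_i\}_{i\in I},\{\overline{\phi}_i\}_{i\in I}\rangle$ with $\langle A,\vee,\wedge,0,1\rangle$ a bounded distributive lattice such that for all $i,j\in I$, $x,y\in A$: $\phi_i$ is a bounded lattice endomorphism; $\phi_i x\vee\overline{\phi}_i x=1$, $\phi_i x\wedge\overline{\phi}_i x=0$; $\phi_i\phi_j x=\phi_j x$; $i\le j$ implies $\phi_i x\le\phi_j x$; $\phi_i x=\phi_i y$ for all $i$ implies $x=y$. $C(A)$ is the set of complemented elements of the lattice $A$. A Boolean congruence is a congruence having a complement in the lattice of all congruences of $A$. -}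

module Defs where

open import Level using (Level; _⊔_; suc)
open import Data.Product using (Σ; Σ-syntax; ∃; _×_; _,_; proj₁)
open import Relation.Binary.PropositionalEquality using (_≡_)
open import Relation.Binary.Bundles using (TotalOrder)
open import Relation.Binary.Structures using (IsEquivalence)
open import Algebra.Core using (Op₁; Op₂)
open import Algebra.Lattice.Structures using (IsDistributiveLattice)

-- LM_θ-algebras, where θ is the order type of J = {0} + I and I is a
-- totally ordered set (the index set of the operations φ_i, φ̄_i).
-- The carrier equality is propositional equality.
record LMAlgebra {c ℓ₁ ℓ₂ : Level} (I : TotalOrder c ℓ₁ ℓ₂) (a : Level)
       : Set (c ⊔ ℓ₂ ⊔ suc a) where
  open TotalOrder I renaming (Carrier to Idx; _≤_ to _≤ᵢ_)
  infixr 6 _∨_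
  infixr 7 _∧_
  field
    Carrier : Set a
    _∨_ _∧_ : Op₂ Carrier
    𝟘 𝟙 : Carrier
    isDistributiveLattice : IsDistributiveLattice _≡_ _∨_ _∧_
    𝟘-least : ∀ x → 𝟘 ∧ x ≡ 𝟘
    𝟙-greatest : ∀ x → x ∨ 𝟙 ≡ 𝟙
    φ φ̄ : Idx → Op₁ Carrier
    φ-∨ : ∀ i x y → φ i (x ∨ y) ≡ φ i x ∨ φ i y
    φ-∧ : ∀ i x y → φ i (x ∧ y) ≡ φ i x ∧ φ i y
    φ-𝟘 : ∀ i → φ i 𝟘 ≡ 𝟘
    φ-𝟙 : ∀ i → φ i 𝟙 ≡ 𝟙
    φ-φ̄-∨ : ∀ i x → φ i x ∨ φ̄ i x ≡ 𝟙
    φ-φ̄-∧ : ∀ i x → φ i x ∧ φ̄ i x ≡ 𝟘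
    φφ : ∀ i j x → φ i (φ j x) ≡ φ j x
    φ-mono : ∀ i j x → i ≤ᵢ j → φ i x ∧ φ j x ≡ φ i x
    determination : ∀ x y → (∀ i → φ i x ≡ φ i y) → x ≡ y

  _≤_ : Carrier → Carrier → Set a
  x ≤ y = x ∧ y ≡ x

  IsComplemented : Carrier → Set a
  IsComplemented x = Σ[ y ∈ Carrier ] (x ∨ y ≡ 𝟙 × x ∧ y ≡ 𝟘)

  C : Set a
  C = Σ[ x ∈ Carrier ] IsComplemented x

  record Congruence : Set (c ⊔ suc a) where
    field
      R : Carrier → Carrier → Set a
      isEquivalence : IsEquivalence R
      ∨-compat : ∀ {x y u v} → R x y → R u v → R (x ∨ u) (y ∨ v)
      ∧-compat : ∀ {x y u v} → R x y → R u v → R (x ∧ u) (y ∧ v)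
      φ-compat : ∀ i {x y} → R x y → R (φ i x) (φ i y)
      φ̄-compat : ∀ i {x y} → R x y → R (φ̄ i x) (φ̄ i y)
  open Congruence public

  _⊆_ : Congruence → Congruence → Set a
  θ ⊆ ψ = ∀ x y → R θ x y → R ψ x y

  _≋_ : Congruence → Congruence → Set a
  θ ≋ ψ = θ ⊆ ψ × ψ ⊆ θ

  data Join (θ ψ : Congruence) : Carrier → Carrier → Set (c ⊔ a) where
    inl : ∀ {x y} → R θ x y → Join θ ψ x y
    inr : ∀ {x y} → R ψ x y → Join θ ψ x y
    refl′ : ∀ {x} → Join θ ψ x x
    sym′ : ∀ {x y} → Join θ ψ x y → Join θ ψ y x
    trans′ : ∀ {x y z} → Join θ ψ x y → Join θ ψ y z → Join θ ψ x z
    ∨-c : ∀ {x y u v} → Join θ ψ x y → Join θ ψ u v → Join θ ψ (x ∨ u) (y ∨ v)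
    ∧-c : ∀ {x y u v} → Join θ ψ x y → Join θ ψ u v → Join θ ψ (x ∧ u) (y ∧ v)
    φ-c : ∀ i {x y} → Join θ ψ x y → Join θ ψ (φ i x) (φ i y)
    φ̄-c : ∀ i {x y} → Join θ ψ x y → Join θ ψ (φ̄ i x) (φ̄ i y)

  IsComplementOf : Congruence → Congruence → Set (c ⊔ a)
  IsComplementOf ψ θ =
    (∀ x y → R θ x y → R ψ x y → x ≡ y) × (∀ x y → Join θ ψ x y)

  IsBoolean : Congruence → Set (c ⊔ suc a)
  IsBoolean θ = Σ[ ψ ∈ Congruence ] IsComplementOf ψ θ

  ConB : Set (c ⊔ suc a)
  ConB = Σ[ θ ∈ Congruence ] IsBoolean θ

-- An isomorphism of the (bounded) lattices Con_b(A) (ordered by inclusion,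
-- equality = mutual inclusion) and C(A) (ordered by the lattice order of A,
-- equality = equality of underlying elements): a bijection that preserves
-- and reflects the order (an order isomorphism between lattices is a
-- lattice isomorphism, hence a Boolean algebra isomorphism).
record BooleanIso {c ℓ₁ ℓ₂ a} {I : TotalOrder c ℓ₁ ℓ₂} (A : LMAlgebra I a)
       : Set (c ⊔ suc a) where
  open LMAlgebra A
  field
    to : ConB → C
    to-cong : ∀ θ ψ → proj₁ θ ≋ proj₁ ψ → proj₁ (to θ) ≡ proj₁ (to ψ)
    to-injective : ∀ θ ψ → proj₁ (to θ) ≡ proj₁ (to ψ) → proj₁ θ ≋ proj₁ ψ
    to-surjective : ∀ (x : C) → Σ[ θ ∈ ConB ] proj₁ (to θ) ≡ proj₁ x
    to-monotone : ∀ θ ψ → proj₁ θ ⊆ proj₁ ψ → proj₁ (to θ) ≤ proj₁ (to ψ)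
    to-reflects : ∀ θ ψ → proj₁ (to θ) ≤ proj₁ (to ψ) → proj₁ θ ⊆ proj₁ ψ

{-# OPTIONS --safe #-}

-- Complemented elements are fixed by every φ_i, so for a complemented g the
-- relation x ∧ g = y ∧ g is a congruence, and the congruences of g and of its
-- complement are complementary.  Conversely, let θ and ψ be complementary.
-- Every pair related by the join θ ∨ ψ has φ_i-images that agree below f ∧ g
-- for some f θ-related and g ψ-related to 1; for the pair (0, 1) this forces
-- f ∧ g = 0.  Then e = φ̄_i f is complemented, e θ 0 and e ψ 1, and since
-- θ ∩ ψ = Δ this makes θ the kernel of x ↦ x ∨ e.  Hence e is unique, larger
-- congruences give larger e, and θ ↦ e is the isomorphism.

module Submission where

open import Algebra.Bundles using (CommutativeSemigroup)
open import Algebra.Core using (Op₂)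
open import Algebra.Lattice.Bundles using (Lattice)
open import Algebra.Lattice.Structures using (IsDistributiveLattice)
open import Data.Product using (Σ-syntax; _×_; _,_; proj₁; proj₂)
open import Data.Sum using (inj₁; inj₂)
open import Function using (_∘_; id)
open import Relation.Binary.Bundles using (TotalOrder; Setoid)
open import Relation.Binary.Structures using (IsEquivalence)
open import Relation.Binary.PropositionalEquality as ≡
  using (_≡_; cong; cong₂; subst; subst₂; module ≡-Reasoning)
import Relation.Binary.Construct.On as On
import Relation.Binary.Reasoning.Setoid as SetoidReasoning
open import Defs

module BoundedDistributiveLatticeProperties
  {a} {X : Set a} {_∨_ _∧_ : Op₂ X} {𝟘 𝟙 : X}
  (isDistributiveLattice : IsDistributiveLattice _≡_ _∨_ _∧_)
  (𝟘-least : ∀ x → 𝟘 ∧ x ≡ 𝟘) (𝟙-greatest : ∀ x → x ∨ 𝟙 ≡ 𝟙) where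

  open IsDistributiveLattice isDistributiveLattice
  open ≡-Reasoning

  private
    lattice : Lattice a a
    lattice = record { isLattice = isLattice }

  open import Algebra.Lattice.Properties.Lattice lattice public
    using (∧-idem; ∧-isSemigroup)

  private
    ∧-commutativeSemigroup : CommutativeSemigroup a a
    ∧-commutativeSemigroup = record
      { isCommutativeSemigroup = record
        { isSemigroup = ∧-isSemigroup ; comm = ∧-comm } }

  open import Algebra.Properties.CommutativeSemigroup ∧-commutativeSemigroup public
    using () renaming
      ( interchange to ∧-interchange
      ; x∙yz≈y∙xz to ∧-swap
      ; xy∙z≈x∙zy to ∧-rotate
      ; xy∙z≈zy∙x to ∧-reverse
      )

  ∧-identityʳ : ∀ x → x ∧ 𝟙 ≡ x
  ∧-identityʳ x = ≡.trans (cong (x ∧_) (≡.sym (𝟙-greatest x))) (∧-absorbs-∨ x 𝟙)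

  ∧-identityˡ : ∀ x → 𝟙 ∧ x ≡ x
  ∧-identityˡ x = ≡.trans (∧-comm 𝟙 x) (∧-identityʳ x)

  ∧-zeroʳ : ∀ x → x ∧ 𝟘 ≡ 𝟘
  ∧-zeroʳ x = ≡.trans (∧-comm x 𝟘) (𝟘-least x)

  ∨-identityʳ : ∀ x → x ∨ 𝟘 ≡ x
  ∨-identityʳ x = ≡.trans (cong (x ∨_) (≡.sym (∧-zeroʳ x))) (∨-absorbs-∧ x 𝟘)

  ∨-identityˡ : ∀ x → 𝟘 ∨ x ≡ x
  ∨-identityˡ x = ≡.trans (∨-comm 𝟘 x) (∨-identityʳ x)

  ∨-zeroˡ : ∀ x → 𝟙 ∨ x ≡ 𝟙
  ∨-zeroˡ x = ≡.trans (∨-comm 𝟙 x) (𝟙-greatest x)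

  ∧-distribʳ-∧ : ∀ k x y → (x ∧ y) ∧ k ≡ (x ∧ k) ∧ (y ∧ k)
  ∧-distribʳ-∧ k x y = begin
    (x ∧ y) ∧ k        ≡⟨ cong ((x ∧ y) ∧_) (∧-idem k) ⟨
    (x ∧ y) ∧ (k ∧ k)  ≡⟨ ∧-interchange x y k k ⟩
    (x ∧ k) ∧ (y ∧ k)  ∎

  infix 4 _≤_

  _≤_ : X → X → Set a
  x ≤ y = x ∧ y ≡ x

  ≤-reflexive : ∀ {x y} → x ≡ y → x ≤ y
  ≤-reflexive {x} ≡.refl = ∧-idem x

  ≤-antisym : ∀ {x y} → x ≤ y → y ≤ x → x ≡ y
  ≤-antisym {x} {y} x≤y y≤x = ≡.trans (≡.sym x≤y) (≡.trans (∧-comm x y) y≤x)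

  x∧y≤x : ∀ x y → x ∧ y ≤ x
  x∧y≤x x y = begin
    (x ∧ y) ∧ x  ≡⟨ ∧-comm (x ∧ y) x ⟩
    x ∧ (x ∧ y)  ≡⟨ ∧-assoc x x y ⟨
    (x ∧ x) ∧ y  ≡⟨ cong (_∧ y) (∧-idem x) ⟩
    x ∧ y        ∎

  x∧y≤y : ∀ x y → x ∧ y ≤ y
  x∧y≤y x y = subst (_≤ y) (∧-comm y x) (x∧y≤x y x)

  ≤⇒∨≡ : ∀ {x y} → x ≤ y → x ∨ y ≡ y
  ≤⇒∨≡ {x} {y} x≤y = begin
    x ∨ y        ≡⟨ cong (_∨ y) x≤y ⟨
    (x ∧ y) ∨ y  ≡⟨ ∨-comm (x ∧ y) y ⟩
    y ∨ (x ∧ y)  ≡⟨ cong (y ∨_) (∧-comm x y) ⟩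
    y ∨ (y ∧ x)  ≡⟨ ∨-absorbs-∧ y x ⟩
    y            ∎

  ∨≡⇒≤ : ∀ {x y} → x ∨ y ≡ y → x ≤ y
  ∨≡⇒≤ {x} {y} x∨y≡y = ≡.trans (cong (x ∧_) (≡.sym x∨y≡y)) (∧-absorbs-∨ x y)

  disjoint⇒≤ : ∀ {u w v} → u ∨ w ≡ 𝟙 → v ∧ u ≡ 𝟘 → v ≤ w
  disjoint⇒≤ {u} {w} {v} u∨w≡𝟙 v∧u≡𝟘 = begin
    v ∧ w              ≡⟨ ∨-identityˡ (v ∧ w) ⟨
    𝟘 ∨ (v ∧ w)        ≡⟨ cong (_∨ (v ∧ w)) v∧u≡𝟘 ⟨
    (v ∧ u) ∨ (v ∧ w)  ≡⟨ ∧-distribˡ-∨ v u w ⟨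
    v ∧ (u ∨ w)        ≡⟨ cong (v ∧_) u∨w≡𝟙 ⟩
    v ∧ 𝟙              ≡⟨ ∧-identityʳ v ⟩
    v                  ∎

  Complements : X → X → Set a
  Complements x y = x ∨ y ≡ 𝟙 × x ∧ y ≡ 𝟘

  complements-sym : ∀ {x y} → Complements x y → Complements y x
  complements-sym {x} {y} (x∨y≡𝟙 , x∧y≡𝟘) =
    ≡.trans (∨-comm y x) x∨y≡𝟙 , ≡.trans (∧-comm y x) x∧y≡𝟘

  complement-unique : ∀ {x y z} → Complements x y → Complements x z → y ≡ z
  complement-unique {x} {y} {z} (x∨y≡𝟙 , x∧y≡𝟘) (x∨z≡𝟙 , x∧z≡𝟘) = ≤-antisym
    (disjoint⇒≤ x∨z≡𝟙 (≡.trans (∧-comm y x) x∧y≡𝟘))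
    (disjoint⇒≤ x∨y≡𝟙 (≡.trans (∧-comm z x) x∧z≡𝟘))

  infix 4 _≈[_]_

  _≈[_]_ : X → X → X → Set a
  x ≈[ k ] y = x ∧ k ≡ y ∧ k

  ≈[]-anti : ∀ {k l x y} → l ≤ k → x ≈[ k ] y → x ≈[ l ] y
  ≈[]-anti {k} {l} {x} {y} l≤k x≈y = begin
    x ∧ l        ≡⟨ restrict x ⟩
    (x ∧ k) ∧ l  ≡⟨ cong (_∧ l) x≈y ⟩
    (y ∧ k) ∧ l  ≡⟨ restrict y ⟨
    y ∧ l        ∎
    where
    restrict : ∀ z → z ∧ l ≡ (z ∧ k) ∧ l
    restrict z = begin
      z ∧ l        ≡⟨ cong (z ∧_) l≤k ⟨
      z ∧ (l ∧ k)  ≡⟨ cong (z ∧_) (∧-comm l k) ⟩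
      z ∧ (k ∧ l)  ≡⟨ ∧-assoc z k l ⟨
      (z ∧ k) ∧ l  ∎

  ≈[]-∨ : ∀ {k x y u v} → x ≈[ k ] y → u ≈[ k ] v → x ∨ u ≈[ k ] y ∨ v
  ≈[]-∨ {k} {x} {y} {u} {v} x≈y u≈v = begin
    (x ∨ u) ∧ k        ≡⟨ ∧-distribʳ-∨ k x u ⟩
    (x ∧ k) ∨ (u ∧ k)  ≡⟨ cong₂ _∨_ x≈y u≈v ⟩
    (y ∧ k) ∨ (v ∧ k)  ≡⟨ ∧-distribʳ-∨ k y v ⟨
    (y ∨ v) ∧ k        ∎

  ≈[]-∧ : ∀ {k x y u v} → x ≈[ k ] y → u ≈[ k ] v → x ∧ u ≈[ k ] y ∧ v
  ≈[]-∧ {k} {x} {y} {u} {v} x≈y u≈v = begin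
    (x ∧ u) ∧ k        ≡⟨ ∧-distribʳ-∧ k x u ⟩
    (x ∧ k) ∧ (u ∧ k)  ≡⟨ cong₂ _∧_ x≈y u≈v ⟩
    (y ∧ k) ∧ (v ∧ k)  ≡⟨ ∧-distribʳ-∧ k y v ⟨
    (y ∧ v) ∧ k        ∎

  ≈[]-complement : ∀ {k a ā b b̄} → Complements a ā → Complements b b̄ →
                   a ≈[ k ] b → ā ≈[ k ] b̄
  ≈[]-complement {k} {a} {ā} {b} {b̄} (a∨ā≡𝟙 , a∧ā≡𝟘) (b∨b̄≡𝟙 , b∧b̄≡𝟘) a≈b = begin
    ā ∧ k        ≡⟨ below a∧ā≡𝟘 b∨b̄≡𝟙 a≈b ⟨
    (ā ∧ k) ∧ b̄  ≡⟨ ∧-reverse ā k b̄ ⟩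
    (b̄ ∧ k) ∧ ā  ≡⟨ below b∧b̄≡𝟘 a∨ā≡𝟙 (≡.sym a≈b) ⟩
    b̄ ∧ k        ∎
    where
    below : ∀ {c c̄ d d̄} → c ∧ c̄ ≡ 𝟘 → d ∨ d̄ ≡ 𝟙 → c ≈[ k ] d → c̄ ∧ k ≤ d̄
    below {c} {c̄} {d} {d̄} c∧c̄≡𝟘 d∨d̄≡𝟙 c≈d = disjoint⇒≤ d∨d̄≡𝟙 (begin
      (c̄ ∧ k) ∧ d  ≡⟨ ∧-rotate c̄ k d ⟩
      c̄ ∧ (d ∧ k)  ≡⟨ cong (c̄ ∧_) c≈d ⟨
      c̄ ∧ (c ∧ k)  ≡⟨ ∧-assoc c̄ c k ⟨
      (c̄ ∧ c) ∧ k  ≡⟨ cong (_∧ k) (≡.trans (∧-comm c̄ c) c∧c̄≡𝟘) ⟩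
      𝟘 ∧ k        ≡⟨ 𝟘-least k ⟩
      𝟘            ∎)

  ≈[]-biimplication : ∀ {a ā b b̄} → a ∧ ā ≡ 𝟘 → b ∧ b̄ ≡ 𝟘 →
                      a ≈[ (a ∧ b) ∨ (ā ∧ b̄) ] b
  ≈[]-biimplication {a} {ā} {b} {b̄} a∧ā≡𝟘 b∧b̄≡𝟘 = begin
    a ∧ ((a ∧ b) ∨ (ā ∧ b̄))  ≡⟨ meet-biimplication a∧ā≡𝟘 ⟩
    a ∧ b                    ≡⟨ ∧-comm a b ⟩
    b ∧ a                    ≡⟨ meet-biimplication b∧b̄≡𝟘 ⟨
    b ∧ ((b ∧ a) ∨ (b̄ ∧ ā))  ≡⟨ cong (b ∧_) (cong₂ _∨_ (∧-comm b a) (∧-comm b̄ ā)) ⟩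
    b ∧ ((a ∧ b) ∨ (ā ∧ b̄))  ∎
    where
    meet-biimplication : ∀ {u ū v v̄} → u ∧ ū ≡ 𝟘 → u ∧ ((u ∧ v) ∨ (ū ∧ v̄)) ≡ u ∧ v
    meet-biimplication {u} {ū} {v} {v̄} u∧ū≡𝟘 = begin
      u ∧ ((u ∧ v) ∨ (ū ∧ v̄))        ≡⟨ ∧-distribˡ-∨ u (u ∧ v) (ū ∧ v̄) ⟩
      (u ∧ (u ∧ v)) ∨ (u ∧ (ū ∧ v̄))  ≡⟨ cong₂ _∨_ (∧-assoc u u v) (∧-assoc u ū v̄) ⟨
      ((u ∧ u) ∧ v) ∨ ((u ∧ ū) ∧ v̄)  ≡⟨ cong₂ _∨_ (cong (_∧ v) (∧-idem u))
                                                 (≡.trans (cong (_∧ v̄) u∧ū≡𝟘) (𝟘-least v̄)) ⟩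
      (u ∧ v) ∨ 𝟘                    ≡⟨ ∨-identityʳ (u ∧ v) ⟩
      u ∧ v                          ∎

  ≈[]-separated : ∀ {g h x y} → g ∨ h ≡ 𝟙 → x ≈[ g ] y → x ≈[ h ] y → x ≡ y
  ≈[]-separated {g} {h} {x} {y} g∨h≡𝟙 x≈y x≈′y = begin
    x                  ≡⟨ ∧-identityʳ x ⟨
    x ∧ 𝟙              ≡⟨ cong (x ∧_) g∨h≡𝟙 ⟨
    x ∧ (g ∨ h)        ≡⟨ ∧-distribˡ-∨ x g h ⟩
    (x ∧ g) ∨ (x ∧ h)  ≡⟨ cong₂ _∨_ x≈y x≈′y ⟩
    (y ∧ g) ∨ (y ∧ h)  ≡⟨ ∧-distribˡ-∨ y g h ⟨
    y ∧ (g ∨ h)        ≡⟨ cong (y ∧_) g∨h≡𝟙 ⟩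
    y ∧ 𝟙              ≡⟨ ∧-identityʳ y ⟩
    y                  ∎

  𝟘≈[]𝟙⇒≡𝟘 : ∀ {k} → 𝟘 ≈[ k ] 𝟙 → k ≡ 𝟘
  𝟘≈[]𝟙⇒≡𝟘 {k} 𝟘≈𝟙 = ≡.trans (≡.sym (∧-identityˡ k)) (≡.trans (≡.sym 𝟘≈𝟙) (𝟘-least k))

  ≈[]-∨-disjoint : ∀ {g h} → g ∧ h ≡ 𝟘 → ∀ x → x ≈[ h ] x ∨ g
  ≈[]-∨-disjoint {g} {h} g∧h≡𝟘 x = begin
    x ∧ h              ≡⟨ ∨-identityʳ (x ∧ h) ⟨
    (x ∧ h) ∨ 𝟘        ≡⟨ cong ((x ∧ h) ∨_) g∧h≡𝟘 ⟨
    (x ∧ h) ∨ (g ∧ h)  ≡⟨ ∧-distribʳ-∨ h x g ⟨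
    (x ∨ g) ∧ h        ∎

  ∨≈[]𝟙 : ∀ g x → x ∨ g ≈[ g ] 𝟙
  ∨≈[]𝟙 g x = begin
    (x ∨ g) ∧ g  ≡⟨ ∧-comm (x ∨ g) g ⟩
    g ∧ (x ∨ g)  ≡⟨ cong (g ∧_) (∨-comm x g) ⟩
    g ∧ (g ∨ x)  ≡⟨ ∧-absorbs-∨ g x ⟩
    g            ≡⟨ ∧-identityˡ g ⟨
    𝟙 ∧ g        ∎

module LMAlgebraProperties {c ℓ₁ ℓ₂ a} {I : TotalOrder c ℓ₁ ℓ₂} (A : LMAlgebra I a) where

  open TotalOrder I using (total) renaming (Carrier to Idx; _≤_ to _≤ᵢ_)
  open LMAlgebra A
  open IsDistributiveLattice isDistributiveLattice using (∨-assoc; ∧-comm)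
  open BoundedDistributiveLatticeProperties isDistributiveLattice 𝟘-least 𝟙-greatest
    hiding (_≤_)

  φ-complements : ∀ i x → Complements (φ i x) (φ̄ i x)
  φ-complements i x = φ-φ̄-∨ i x , φ-φ̄-∧ i x

  φ-preserves-complements : ∀ i {x y} → Complements x y → Complements (φ i x) (φ i y)
  φ-preserves-complements i {x} {y} (x∨y≡𝟙 , x∧y≡𝟘) =
    ≡.trans (≡.sym (φ-∨ i x y)) (≡.trans (cong (φ i) x∨y≡𝟙) (φ-𝟙 i)) ,
    ≡.trans (≡.sym (φ-∧ i x y)) (≡.trans (cong (φ i) x∧y≡𝟘) (φ-𝟘 i))

  φφ̄ : ∀ i j x → φ i (φ̄ j x) ≡ φ̄ j x
  φφ̄ i j x = complement-unique
    (subst (λ z → Complements z (φ i (φ̄ j x))) (φφ i j x)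
           (φ-preserves-complements i (φ-complements j x)))
    (φ-complements j x)

  φ-antitone-on-complemented : ∀ {g h i j} → Complements g h → i ≤ᵢ j → φ j g ≤ φ i g
  φ-antitone-on-complemented {g} {h} {i} {j} g⊥h i≤j =
    disjoint⇒≤ (proj₁ (complements-sym (φ-preserves-complements i g⊥h))) (begin
      φ j g ∧ φ i h              ≡⟨ cong (φ j g ∧_) (φ-mono i j h i≤j) ⟨
      φ j g ∧ (φ i h ∧ φ j h)    ≡⟨ ∧-swap (φ j g) (φ i h) (φ j h) ⟩
      φ i h ∧ (φ j g ∧ φ j h)    ≡⟨ cong (φ i h ∧_) (proj₂ (φ-preserves-complements j g⊥h)) ⟩
      φ i h ∧ 𝟘                  ≡⟨ ∧-zeroʳ (φ i h) ⟩
      𝟘                          ∎)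
    where open ≡-Reasoning

  φ-constant-on-complemented : ∀ {g h} → Complements g h → ∀ i j → φ i g ≡ φ j g
  φ-constant-on-complemented {g} g⊥h i j with total i j
  ... | inj₁ i≤j = ≤-antisym (φ-mono i j g i≤j) (φ-antitone-on-complemented g⊥h i≤j)
  ... | inj₂ j≤i = ≤-antisym (φ-antitone-on-complemented g⊥h j≤i) (φ-mono j i g j≤i)

  φ-fixes-complemented : ∀ {g h} → Complements g h → ∀ i → φ i g ≡ g
  φ-fixes-complemented {g} g⊥h i = ≡.sym (determination g (φ i g) λ j →
    ≡.trans (φ-constant-on-complemented g⊥h j i) (≡.sym (φφ j i g)))

  ≈[]-φ : ∀ i {k x y} → x ≈[ k ] y → φ i x ≈[ φ i k ] φ i y
  ≈[]-φ i {k} {x} {y} x≈y = begin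
    φ i x ∧ φ i k  ≡⟨ φ-∧ i x k ⟨
    φ i (x ∧ k)    ≡⟨ cong (φ i) x≈y ⟩
    φ i (y ∧ k)    ≡⟨ φ-∧ i y k ⟩
    φ i y ∧ φ i k  ∎
    where open ≡-Reasoning

  ≈[]-φ̄ : ∀ i {k x y} → x ≈[ k ] y → φ̄ i x ≈[ φ i k ] φ̄ i y
  ≈[]-φ̄ i {x = x} {y} x≈y =
    ≈[]-complement (φ-complements i x) (φ-complements i y) (≈[]-φ i x≈y)

  congruenceSetoid : Congruence → Setoid a a
  congruenceSetoid θ = record { isEquivalence = isEquivalence θ }

  module CongruenceReasoning (θ : Congruence) =
    SetoidReasoning (congruenceSetoid θ)

  ∼-refl : ∀ θ {x} → R θ x x
  ∼-refl θ = IsEquivalence.refl (isEquivalence θ)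

  ∧-∼𝟙 : ∀ θ {f g} → R θ f 𝟙 → R θ g 𝟙 → R θ (f ∧ g) 𝟙
  ∧-∼𝟙 θ f∼𝟙 g∼𝟙 = subst (R θ _) (∧-idem 𝟙) (∧-compat θ f∼𝟙 g∼𝟙)

  meetCongruence : ∀ {g h} → Complements g h → Congruence
  meetCongruence {g} g⊥h = record
    { R = _≈[ g ]_
    ; isEquivalence = On.isEquivalence (_∧ g) ≡.isEquivalence
    ; ∨-compat = ≈[]-∨
    ; ∧-compat = ≈[]-∧
    ; φ-compat = λ i → subst (_ ≈[_] _) (φ-fixes-complemented g⊥h i) ∘ ≈[]-φ i
    ; φ̄-compat = λ i → subst (_ ≈[_] _) (φ-fixes-complemented g⊥h i) ∘ ≈[]-φ̄ i
    }

  meetCongruences-complementary : ∀ {g h} (g⊥h : Complements g h) →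
    IsComplementOf (meetCongruence g⊥h) (meetCongruence (complements-sym g⊥h))
  meetCongruences-complementary {g} g⊥h@(g∨h≡𝟙 , g∧h≡𝟘) =
    (λ x y x≈y x≈′y → ≈[]-separated g∨h≡𝟙 x≈′y x≈y) ,
    (λ x y → trans′ (joins-𝟙 x) (sym′ (joins-𝟙 y)))
    where
    joins-𝟙 : ∀ x → Join (meetCongruence (complements-sym g⊥h)) (meetCongruence g⊥h) x 𝟙
    joins-𝟙 x = trans′ (inl (≈[]-∨-disjoint g∧h≡𝟘 x)) (inr (∨≈[]𝟙 g x))

  record Witness (θ ψ : Congruence) (x y : Carrier) : Set a where
    constructor witness
    field
      f g : Carrier
      f∼𝟙 : R θ f 𝟙
      g∼𝟙 : R ψ g 𝟙
      agree : x ≈[ f ∧ g ] y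

  module _ {θ ψ : Congruence} where

    mapWitness : ∀ {x y p q} → (∀ {k} → x ≈[ k ] y → p ≈[ k ] q) →
                 Witness θ ψ x y → Witness θ ψ p q
    mapWitness transform (witness f g f∼𝟙 g∼𝟙 x≈y) = witness f g f∼𝟙 g∼𝟙 (transform x≈y)

    mergeWitness : ∀ {x y u v p q} → (∀ {k} → x ≈[ k ] y → u ≈[ k ] v → p ≈[ k ] q) →
            Witness θ ψ x y → Witness θ ψ u v → Witness θ ψ p q
    mergeWitness combine (witness f₁ g₁ f₁∼𝟙 g₁∼𝟙 x≈y) (witness f₂ g₂ f₂∼𝟙 g₂∼𝟙 u≈v) =
      witness (f₁ ∧ f₂) (g₁ ∧ g₂) (∧-∼𝟙 θ f₁∼𝟙 f₂∼𝟙) (∧-∼𝟙 ψ g₁∼𝟙 g₂∼𝟙)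
        (combine (≈[]-anti (below (x∧y≤x _ _)) x≈y) (≈[]-anti (below (x∧y≤y _ _)) u≈v))
      where
      below : ∀ {k} → ((f₁ ∧ g₁) ∧ (f₂ ∧ g₂)) ≤ k → ((f₁ ∧ f₂) ∧ (g₁ ∧ g₂)) ≤ k
      below = subst (_≤ _) (≡.sym (∧-interchange f₁ f₂ g₁ g₂))

  φ-biimplication : Idx → Carrier → Carrier → Carrier
  φ-biimplication i x y = (φ i x ∧ φ i y) ∨ (φ̄ i x ∧ φ̄ i y)

  φ-biimplication-∼𝟙 : ∀ θ i {x y} → R θ x y → R θ (φ-biimplication i x y) 𝟙
  φ-biimplication-∼𝟙 θ i {x} {y} x∼y = begin
    (φ i x ∧ φ i y) ∨ (φ̄ i x ∧ φ̄ i y)  ≈⟨ ∨-compat θ (∧-compat θ (φ-compat θ i x∼y) (∼-refl θ))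
                                                    (∧-compat θ (φ̄-compat θ i x∼y) (∼-refl θ)) ⟩
    (φ i y ∧ φ i y) ∨ (φ̄ i y ∧ φ̄ i y)  ≡⟨ cong₂ _∨_ (∧-idem (φ i y)) (∧-idem (φ̄ i y)) ⟩
    φ i y ∨ φ̄ i y                      ≡⟨ φ-φ̄-∨ i y ⟩
    𝟙                                  ∎
    where open CongruenceReasoning θ

  φ-≈[biimplication] : ∀ i x y → φ i x ≈[ φ-biimplication i x y ] φ i y
  φ-≈[biimplication] i x y = ≈[]-biimplication (φ-φ̄-∧ i x) (φ-φ̄-∧ i y)

  -- The invariant is about φ_i-images because these are complemented, and
  -- related complemented elements agree below their biimplication, which is
  -- related to 1.
  join⇒witness : ∀ {θ ψ x y} → Join θ ψ x y → ∀ i → Witness θ ψ (φ i x) (φ i y)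
  join⇒witness {θ} {ψ} (inl x∼y) i = witness _ 𝟙 (φ-biimplication-∼𝟙 θ i x∼y) (∼-refl ψ)
    (subst (_ ≈[_] _) (≡.sym (∧-identityʳ _)) (φ-≈[biimplication] i _ _))
  join⇒witness {θ} {ψ} (inr x∼y) i = witness 𝟙 _ (∼-refl θ) (φ-biimplication-∼𝟙 ψ i x∼y)
    (subst (_ ≈[_] _) (≡.sym (∧-identityˡ _)) (φ-≈[biimplication] i _ _))
  join⇒witness {θ} {ψ} refl′ i = witness 𝟙 𝟙 (∼-refl θ) (∼-refl ψ) ≡.refl
  join⇒witness (sym′ d) i = mapWitness ≡.sym (join⇒witness d i)
  join⇒witness (trans′ d₁ d₂) i = mergeWitness ≡.trans (join⇒witness d₁ i) (join⇒witness d₂ i)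
  join⇒witness (∨-c {x} {y} {u} {v} d₁ d₂) i = mergeWitness
    (λ x≈y u≈v → subst₂ (_≈[ _ ]_) (≡.sym (φ-∨ i x u)) (≡.sym (φ-∨ i y v)) (≈[]-∨ x≈y u≈v))
    (join⇒witness d₁ i) (join⇒witness d₂ i)
  join⇒witness (∧-c {x} {y} {u} {v} d₁ d₂) i = mergeWitness
    (λ x≈y u≈v → subst₂ (_≈[ _ ]_) (≡.sym (φ-∧ i x u)) (≡.sym (φ-∧ i y v)) (≈[]-∧ x≈y u≈v))
    (join⇒witness d₁ i) (join⇒witness d₂ i)
  join⇒witness (φ-c j {x} {y} d) i = mapWitness
    (subst₂ (_≈[ _ ]_) (≡.sym (φφ i j x)) (≡.sym (φφ i j y)))
    (join⇒witness d j)
  join⇒witness (φ̄-c j {x} {y} d) i = mapWitness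
    (subst₂ (_≈[ _ ]_) (≡.sym (φφ̄ i j x)) (≡.sym (φφ̄ i j y))
      ∘ ≈[]-complement (φ-complements j x) (φ-complements j y))
    (join⇒witness d j)

  Separates : Congruence → Congruence → Carrier → Set a
  Separates θ ψ e = R θ e 𝟘 × R ψ e 𝟙

  separator : Idx → ∀ {θ ψ} → IsComplementOf ψ θ → Σ[ e ∈ C ] Separates θ ψ (proj₁ e)
  separator i₀ {θ} {ψ} (_ , joins) with join⇒witness (joins 𝟘 𝟙) i₀
  ... | witness f g f∼𝟙 g∼𝟙 φ𝟘≈φ𝟙 =
    (φ̄ i₀ f , φ i₀ f , complements-sym (φ-complements i₀ f)) , e∼𝟘 , e∼𝟙
    where
    f∧g≡𝟘 : f ∧ g ≡ 𝟘
    f∧g≡𝟘 = 𝟘≈[]𝟙⇒≡𝟘 (subst₂ (_≈[ f ∧ g ]_) (φ-𝟘 i₀) (φ-𝟙 i₀) φ𝟘≈φ𝟙)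

    φg≤φ̄f : φ i₀ g ≤ φ̄ i₀ f
    φg≤φ̄f = disjoint⇒≤ (φ-φ̄-∨ i₀ f) (≡.trans (≡.sym (φ-∧ i₀ g f))
      (≡.trans (cong (φ i₀) (≡.trans (∧-comm g f) f∧g≡𝟘)) (φ-𝟘 i₀)))

    e∼𝟘 : R θ (φ̄ i₀ f) 𝟘
    e∼𝟘 = begin
      φ̄ i₀ f            ≡⟨ ∧-identityʳ (φ̄ i₀ f) ⟨
      φ̄ i₀ f ∧ 𝟙        ≈⟨ ∧-compat θ (∼-refl θ) (subst (R θ _) (φ-𝟙 i₀) (φ-compat θ i₀ f∼𝟙)) ⟨
      φ̄ i₀ f ∧ φ i₀ f   ≡⟨ proj₂ (complements-sym (φ-complements i₀ f)) ⟩
      𝟘                 ∎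
      where open CongruenceReasoning θ

    e∼𝟙 : R ψ (φ̄ i₀ f) 𝟙
    e∼𝟙 = begin
      φ̄ i₀ f           ≡⟨ ≤⇒∨≡ φg≤φ̄f ⟨
      φ i₀ g ∨ φ̄ i₀ f  ≈⟨ ∨-compat ψ (subst (R ψ _) (φ-𝟙 i₀) (φ-compat ψ i₀ g∼𝟙)) (∼-refl ψ) ⟩
      𝟙 ∨ φ̄ i₀ f       ≡⟨ ∨-zeroˡ (φ̄ i₀ f) ⟩
      𝟙                ∎
      where open CongruenceReasoning ψ

  ∼⇒∨-≡ : ∀ {θ ψ e} → IsComplementOf ψ θ → Separates θ ψ e →
          ∀ {x y} → R θ x y → x ∨ e ≡ y ∨ e
  ∼⇒∨-≡ {θ} {ψ} {e} (θ∩ψ⊆Δ , _) (_ , e∼𝟙) {x} {y} x∼y =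
    θ∩ψ⊆Δ _ _ (∨-compat θ x∼y (∼-refl θ)) (begin
      x ∨ e  ≈⟨ ∨-compat ψ (∼-refl ψ) e∼𝟙 ⟩
      x ∨ 𝟙  ≡⟨ 𝟙-greatest x ⟩
      𝟙      ≡⟨ 𝟙-greatest y ⟨
      y ∨ 𝟙  ≈⟨ ∨-compat ψ (∼-refl ψ) e∼𝟙 ⟨
      y ∨ e  ∎)
    where open CongruenceReasoning ψ

  ∨-≡⇒∼ : ∀ {θ e} → R θ e 𝟘 → ∀ {x y} → x ∨ e ≡ y ∨ e → R θ x y
  ∨-≡⇒∼ {θ} {e} e∼𝟘 {x} {y} x∨e≡y∨e = begin
    x      ≡⟨ ∨-identityʳ x ⟨
    x ∨ 𝟘  ≈⟨ ∨-compat θ (∼-refl θ) e∼𝟘 ⟨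
    x ∨ e  ≡⟨ x∨e≡y∨e ⟩
    y ∨ e  ≈⟨ ∨-compat θ (∼-refl θ) e∼𝟘 ⟩
    y ∨ 𝟘  ≡⟨ ∨-identityʳ y ⟩
    y      ∎
    where open CongruenceReasoning θ

  separator-mono : ∀ {θ θ′ ψ′ e e′} → IsComplementOf ψ′ θ′ →
                   R θ e 𝟘 → Separates θ′ ψ′ e′ → θ ⊆ θ′ → e ≤ e′
  separator-mono {e′ = e′} θ′⊥ψ′ e∼𝟘 e′-separates θ⊆θ′ =
    ∨≡⇒≤ (≡.trans (∼⇒∨-≡ θ′⊥ψ′ e′-separates (θ⊆θ′ _ _ e∼𝟘)) (∨-identityˡ e′))

  separator-reflects : ∀ {θ ψ θ′ e e′} → IsComplementOf ψ θ →
                       Separates θ ψ e → R θ′ e′ 𝟘 → e ≤ e′ → θ ⊆ θ′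
  separator-reflects {θ′ = θ′} {e} {e′} θ⊥ψ e-separates e′∼𝟘 e≤e′ x y x∼y =
    ∨-≡⇒∼ {θ′} e′∼𝟘 (begin
      x ∨ e′        ≡⟨ cong (x ∨_) (≤⇒∨≡ e≤e′) ⟨
      x ∨ (e ∨ e′)  ≡⟨ ∨-assoc x e e′ ⟨
      (x ∨ e) ∨ e′  ≡⟨ cong (_∨ e′) (∼⇒∨-≡ θ⊥ψ e-separates x∼y) ⟩
      (y ∨ e) ∨ e′  ≡⟨ ∨-assoc y e e′ ⟩
      y ∨ (e ∨ e′)  ≡⟨ cong (y ∨_) (≤⇒∨≡ e≤e′) ⟩
      y ∨ e′        ∎)
    where open ≡-Reasoning

  separator-unique : ∀ {θ ψ e e′} → IsComplementOf ψ θ →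
                     Separates θ ψ e → Separates θ ψ e′ → e ≡ e′
  separator-unique {θ} θ⊥ψ e-separates e′-separates = ≤-antisym
    (separator-mono {θ} θ⊥ψ (proj₁ e-separates) e′-separates λ _ _ → id)
    (separator-mono {θ} θ⊥ψ (proj₁ e′-separates) e-separates λ _ _ → id)

  module BooleanCongruences (i₀ : Idx) where

    key : ConB → C
    key (_ , _ , θ⊥ψ) = proj₁ (separator i₀ θ⊥ψ)

    key-separates : ∀ b → Separates (proj₁ b) (proj₁ (proj₂ b)) (proj₁ (key b))
    key-separates (_ , _ , θ⊥ψ) = proj₂ (separator i₀ θ⊥ψ)

    key-monotone : ∀ b b′ → proj₁ b ⊆ proj₁ b′ → proj₁ (key b) ≤ proj₁ (key b′)
    key-monotone b b′@(_ , _ , θ′⊥ψ′) =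
      separator-mono {proj₁ b} θ′⊥ψ′ (proj₁ (key-separates b)) (key-separates b′)

    key-reflects : ∀ b b′ → proj₁ (key b) ≤ proj₁ (key b′) → proj₁ b ⊆ proj₁ b′
    key-reflects b@(_ , _ , θ⊥ψ) b′ =
      separator-reflects {θ′ = proj₁ b′} θ⊥ψ (key-separates b) (proj₁ (key-separates b′))

    key-cong : ∀ b b′ → proj₁ b ≋ proj₁ b′ → proj₁ (key b) ≡ proj₁ (key b′)
    key-cong b b′ (b⊆b′ , b′⊆b) = ≤-antisym (key-monotone b b′ b⊆b′) (key-monotone b′ b b′⊆b)

    key-injective : ∀ b b′ → proj₁ (key b) ≡ proj₁ (key b′) → proj₁ b ≋ proj₁ b′
    key-injective b b′ key≡ =
      key-reflects b b′ (≤-reflexive key≡) , key-reflects b′ b (≤-reflexive (≡.sym key≡))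

    key-surjective : ∀ (x : C) → Σ[ b ∈ ConB ] proj₁ (key b) ≡ proj₁ x
    key-surjective (g , h , g⊥h@(_ , g∧h≡𝟘)) = b , separator-unique θ⊥ψ (key-separates b) g-separates
      where
      θ⊥ψ = meetCongruences-complementary g⊥h
      b = _ , _ , θ⊥ψ
      g-separates : g ≈[ h ] 𝟘 × g ≈[ g ] 𝟙
      g-separates = ≡.trans g∧h≡𝟘 (≡.sym (𝟘-least h)) , ≡.trans (∧-idem g) (≡.sym (∧-identityˡ g))

corollary4p13 : ∀ {c ℓ₁ ℓ₂ a} (I : TotalOrder c ℓ₁ ℓ₂) → TotalOrder.Carrier I →
                  (A : LMAlgebra I a) → BooleanIso A
corollary4p13 I i₀ A = record
  { to            = key
  ; to-cong       = key-cong
  ; to-injective  = key-injective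
  ; to-surjective = key-surjective
  ; to-monotone   = key-monotone
  ; to-reflects   = key-reflects
  }
  where open LMAlgebraProperties.BooleanCongruences A i₀
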